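{- Consider the deterministic scan bounding chain started from any bounding state whose first entry $r(1)$ is $*$, and track this particular $*$ symbol. Let $\tau$ be the number of sweeps until this $*$ symbol reaches position $n$ (and is replaced by a new active item). Then $\mathbb{E}[\tau]\le (n^2-n+2)/2$.
   Context: Let $n\ge 2$, $\preceq$ a partial order on $[n]$ with the identity permutation a linear extension. A bounding state is $(r,k)$ with $k\in[n]$, $r\in(\{*\}\cup[n])^n$ with distinct numeric entries at most $k$. The bounding step $B((r,k),i,c)$ for $i\in\{1,\dots,n-1\}$, $c\in\{0,1\}$: if $c=1$ and it is not the case that $r(i),r(i+1)\in[n]$ with $r(i)\preceq r(i+1)$, exchange the entries (symbols) in positions $i$ and $i+1$ (so a $*$ is always exchanged with its neighbour when $c=1$); then if $r(n)=*$ set $r(n)\leftarrow k+1$, $k\leftarrow k+1$. A sweep of the deterministic scan chain draws fresh iid fair bits $c_1,\dots,c_{n-1}$ and applies $B(\cdot,i,c_i)$ for $i=1,2,\dots,n-1$ in order. A tracked $*$ symbol moves with the entry exchanges. -}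

module Defs where

open import Data.Bool using (Bool; true; false; if_then_else_; _∧_; not)
open import Data.Nat using (ℕ; zero; suc; _+_; _*_; _∸_; _^_; _≤_; _≤ᵇ_)
open import Data.Nat.Properties using (m^n≢0)
open import Data.List using (List; []; _∷_; length; filter; map; concatMap)
open import Data.Bool.ListAction using (any)
open import Data.Vec using (Vec; []; _∷_)
open import Data.Product using (_×_; _,_)
open import Data.Integer using (+_)
open import Data.Rational using (ℚ; _/_; 0ℚ; _+_)
open import Relation.Nullary using (¬_)
open import Relation.Binary.PropositionalEquality using (_≡_)
open import Data.List.Relation.Unary.All using (All)
open import Data.List.Relation.Unary.Unique.Propositional using (Unique)
open import Data.List.Membership.Propositional using (_∈_)

data Entry : Set where
  star    : Entry
  tracked : Entry
  num     : ℕ → Entry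

isStar : Entry → Bool
isStar star    = true
isStar tracked = true
isStar (num _) = false

isTracked : Entry → Bool
isTracked tracked = true
isTracked _       = false

nums : List Entry → List ℕ
nums []            = []
nums (num a ∷ rs)  = a ∷ nums rs
nums (_ ∷ rs)      = nums rs

inRange : ℕ → ℕ → Bool
inRange n a = (1 ≤ᵇ a) ∧ (a ≤ᵇ n)

blocked : ℕ → (ℕ → ℕ → Bool) → Entry → Entry → Bool
blocked n leq (num a) (num b) = inRange n a ∧ inRange n b ∧ leq a b
blocked n leq _       _       = false

-- exchange positions i and i+1 (0-based i) unless blocked
swapAt : ℕ → (ℕ → ℕ → Bool) → ℕ → List Entry → List Entry
swapAt n leq zero    (x ∷ y ∷ rs) =
  if blocked n leq x y then x ∷ y ∷ rs else y ∷ x ∷ rs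
swapAt n leq (suc i) (x ∷ rs)     = x ∷ swapAt n leq i rs
swapAt n leq _       rs           = rs

fixLast : List Entry → ℕ → List Entry × ℕ
fixLast []           k = [] , k
fixLast (x ∷ [])     k = if isStar x then (num (suc k) ∷ [] , suc k) else (x ∷ [] , k)
fixLast (x ∷ y ∷ rs) k with fixLast (y ∷ rs) k
... | rs' , k' = x ∷ rs' , k'

State : Set
State = List Entry × ℕ

-- bounding step B((r,k), i, c), with 0-based position index i (paper's i+1)
B : ℕ → (ℕ → ℕ → Bool) → State → ℕ → Bool → State
B n leq (r , k) i c = fixLast (if c then swapAt n leq i r else r) k

sweepFrom : ℕ → (ℕ → ℕ → Bool) → ℕ → {m : ℕ} → Vec Bool m → State → State
sweepFrom n leq i []       s = s
sweepFrom n leq i (c ∷ cs) s = sweepFrom n leq (suc i) cs (B n leq s i c)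

sweep : (n : ℕ) → (ℕ → ℕ → Bool) → Vec Bool (n ∸ 1) → State → State
sweep n leq cs s = sweepFrom n leq 0 cs s

runSweeps : (n : ℕ) → (ℕ → ℕ → Bool) → {t : ℕ} → Vec (Vec Bool (n ∸ 1)) t → State → State
runSweeps n leq []         s = s
runSweeps n leq (cs ∷ css) s = runSweeps n leq css (sweep n leq cs s)

-- the tracked * is still present (has not yet reached position n)
alive : State → Bool
alive (r , k) = any isTracked r

allVecs : {A : Set} → List A → (m : ℕ) → List (Vec A m)
allVecs xs zero    = [] ∷ []
allVecs xs (suc m) = concatMap (λ x → map (x ∷_) (allVecs xs m)) xs

-- number of outcomes of t sweeps (out of 2^((n-1)t) equally likely) with τ > t
survivors : (n : ℕ) → (ℕ → ℕ → Bool) → State → ℕ → ℕ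
survivors n leq s t =
  length (filter (λ css → alive (runSweeps n leq css s) ≟b true)
                 (allVecs (allVecs (true ∷ false ∷ []) (n ∸ 1)) t))
  where
  open import Relation.Nullary using (Dec)
  open import Data.Bool.Properties renaming (_≟_ to _≟b_)

probGt : (n : ℕ) → (ℕ → ℕ → Bool) → State → ℕ → ℚ
probGt n leq s t =
  _/_ (+ survivors n leq s t) (2 ^ ((n ∸ 1) * t)) {{m^n≢0 2 ((n ∸ 1) * t)}}

-- Σ_{t < T} P(τ > t)  (partial sums of the tail-sum formula for E[τ])
tailSum : (n : ℕ) → (ℕ → ℕ → Bool) → State → ℕ → ℚ
tailSum n leq s zero    = 0ℚ
tailSum n leq s (suc T) = tailSum n leq s T Data.Rational.+ probGt n leq s T

-- leq is a partial order on [n] having the identity as a linear extension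
IsPartialOrderOn : ℕ → (ℕ → ℕ → Bool) → Set
IsPartialOrderOn n leq =
  (∀ a → 1 ≤ a → a ≤ n → leq a a ≡ true) ×
  (∀ a b → 1 ≤ a → a ≤ n → 1 ≤ b → b ≤ n →
     leq a b ≡ true → leq b a ≡ true → a ≡ b) ×
  (∀ a b c → 1 ≤ a → a ≤ n → 1 ≤ b → b ≤ n → 1 ≤ c → c ≤ n →
     leq a b ≡ true → leq b c ≡ true → leq a c ≡ true) ×
  (∀ a b → 1 ≤ a → a ≤ n → 1 ≤ b → b ≤ n → leq a b ≡ true → a ≤ b)

IsStartState : ℕ → State → Set
IsStartState n (r , k) =
  (length r ≡ n) × (1 ≤ k) × (k ≤ n) ×
  Unique (nums r) × All (λ a → 1 ≤ a × a ≤ k) (nums r) ×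
  (Data.List.head r ≡ Data.Maybe.just tracked) ×
  (Data.List.length (filter (λ e → isTracked e Data.Bool.Properties.≟ true) r) ≡ 1)
  where
  import Data.Maybe
  import Data.Bool.Properties

{-# OPTIONS --safe #-}
module Submission where

-- Whatever ⪯ and the other entries are, the tracked * is exchanged with its neighbour whenever c = 1,
-- so its position q ∈ {0, …, m} (0-based, n = m + 1) is a Markov chain of its own: at step i of a sweep
-- it moves between i and i + 1 with probability 1/2, and on reaching m it is retired. The potential
-- Φ(q) = (m + q)(m + 1 − q) + 2 of a live position, with Φ = 0 after retirement, drops in expectation
-- by exactly 2 per sweep while the * is alive, hence 2 Σ_{t<T} P(τ > t) ≤ Φ(0) = n² − n + 2 for all T.
-- Probabilities are counts over the 2^(mT) equally likely bit sequences, so the argument runs in ℕ.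

open import Defs
open import Data.Bool using (Bool; true; false; if_then_else_)
open import Data.Bool.ListAction using (or)
open import Data.Bool.Properties using () renaming (_≟_ to _≟ᵇ_)
open import Data.Integer as ℤ using (+_)
open import Data.Integer.Properties using (pos-*; pos-+)
open import Data.List using (List; []; _∷_; _++_; map; concatMap; length; filter; replicate)
open import Data.Nat using (ℕ; zero; suc; _+_; _*_; _∸_; _^_; _≤_; _<_; _<ᵇ_; s≤s; z≤n; z<s; NonZero)
open import Data.Nat.Properties
open import Data.Nat.Tactic.RingSolver using (solve-∀)
open import Data.Product using (_,_; proj₁)
open import Data.Rational using (_/_; toℚᵘ)
open import Data.Rational.Properties using (toℚᵘ-fromℚᵘ; toℚᵘ-homo-+; toℚᵘ-cancel-≤)
open import Data.Rational.Unnormalised as ℚᵘ using (mkℚᵘ; 0ℚᵘ; _≃_; *≡*; *≤*)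
open import Data.Rational.Unnormalised.Properties using (≃-sym; +-cong; ≤-respˡ-≃; ≤-respʳ-≃; module ≃-Reasoning)
open import Data.Vec using (Vec; []; _∷_)
open import Function using (_∘_)
open import Relation.Binary.Definitions using (tri<; tri≈; tri>)
open import Relation.Binary.PropositionalEquality
open import Relation.Nullary using (does; yes; no)
open import Relation.Nullary.Decidable using (dec-true; dec-false)
open import Relation.Nullary.Negation using (contradiction)

indicator : Bool → ℕ
indicator b = if b then 1 else 0

module _ {A : Set} where

  sumOver : List A → (A → ℕ) → ℕ
  sumOver []       f = 0
  sumOver (x ∷ xs) f = f x + sumOver xs f

  syntax sumOver xs (λ x → e) = ∑[ x ∈ xs ] e

  sumOver-cong : ∀ xs {f g : A → ℕ} → (∀ x → f x ≡ g x) → ∑[ x ∈ xs ] f x ≡ ∑[ x ∈ xs ] g x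
  sumOver-cong []       f≡g = refl
  sumOver-cong (x ∷ xs) f≡g = cong₂ _+_ (f≡g x) (sumOver-cong xs f≡g)

  sumOver-zero : ∀ xs → ∑[ x ∈ xs ] 0 ≡ 0
  sumOver-zero []       = refl
  sumOver-zero (x ∷ xs) = sumOver-zero xs

  sumOver-mono : ∀ xs {f g : A → ℕ} → (∀ x → f x ≤ g x) → ∑[ x ∈ xs ] f x ≤ ∑[ x ∈ xs ] g x
  sumOver-mono []       f≤g = z≤n
  sumOver-mono (x ∷ xs) f≤g = +-mono-≤ (f≤g x) (sumOver-mono xs f≤g)

  sumOver-+ : ∀ xs (f g : A → ℕ) → ∑[ x ∈ xs ] (f x + g x) ≡ ∑[ x ∈ xs ] f x + ∑[ x ∈ xs ] g x
  sumOver-+ []       f g = refl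
  sumOver-+ (x ∷ xs) f g rewrite sumOver-+ xs f g = identity (f x) (g x) (sumOver xs f) (sumOver xs g)
    where
    identity : ∀ a b c d → a + b + (c + d) ≡ a + c + (b + d)
    identity = solve-∀

  sumOver-* : ∀ xs c (f : A → ℕ) → ∑[ x ∈ xs ] (c * f x) ≡ c * ∑[ x ∈ xs ] f x
  sumOver-* []       c f = sym (*-zeroʳ c)
  sumOver-* (x ∷ xs) c f = trans (cong (_+_ (c * f x)) (sumOver-* xs c f)) (sym (*-distribˡ-+ c (f x) _))

  sumOver-++ : ∀ xs ys (f : A → ℕ) → ∑[ x ∈ xs ++ ys ] f x ≡ ∑[ x ∈ xs ] f x + ∑[ y ∈ ys ] f y
  sumOver-++ []       ys f = refl
  sumOver-++ (x ∷ xs) ys f = trans (cong (_+_ (f x)) (sumOver-++ xs ys f)) (sym (+-assoc (f x) _ _))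

  length-filter-≡true : ∀ xs (p : A → Bool) →
                        length (filter (λ x → p x ≟ᵇ true) xs) ≡ ∑[ x ∈ xs ] indicator (p x)
  length-filter-≡true []       p = refl
  length-filter-≡true (x ∷ xs) p with p x
  ... | true  = cong suc (length-filter-≡true xs p)
  ... | false = length-filter-≡true xs p

  map≡replicate-false : ∀ xs (p : A → Bool) → ∑[ x ∈ xs ] indicator (p x) ≡ 0 →
                        map p xs ≡ replicate (length xs) false
  map≡replicate-false []       p _    = refl
  map≡replicate-false (x ∷ xs) p none with p x
  ... | false = cong (false ∷_) (map≡replicate-false xs p none)

module _ {A B : Set} where

  sumOver-map : ∀ (h : A → B) xs (f : B → ℕ) → ∑[ y ∈ map h xs ] f y ≡ ∑[ x ∈ xs ] f (h x)
  sumOver-map h []       f = refl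
  sumOver-map h (x ∷ xs) f = cong (_+_ (f (h x))) (sumOver-map h xs f)

  sumOver-concatMap : ∀ (h : A → List B) xs (f : B → ℕ) →
                      ∑[ y ∈ concatMap h xs ] f y ≡ ∑[ x ∈ xs ] ∑[ y ∈ h x ] f y
  sumOver-concatMap h []       f = refl
  sumOver-concatMap h (x ∷ xs) f =
    trans (sumOver-++ (h x) (concatMap h xs) f) (cong (_+_ (sumOver (h x) f)) (sumOver-concatMap h xs f))

sumOver-allVecs : ∀ {A : Set} (xs : List A) j (f : Vec A (suc j) → ℕ) →
                  ∑[ v ∈ allVecs xs (suc j) ] f v ≡ ∑[ x ∈ xs ] ∑[ v ∈ allVecs xs j ] f (x ∷ v)
sumOver-allVecs xs j f =
  trans (sumOver-concatMap (λ x → map (x ∷_) (allVecs xs j)) xs f)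
        (sumOver-cong xs (λ x → sumOver-map (x ∷_) (allVecs xs j) f))

bitVecs : (j : ℕ) → List (Vec Bool j)
bitVecs = allVecs (true ∷ false ∷ [])

swapAdj : {A : Set} → ℕ → List A → List A
swapAdj zero    (x ∷ y ∷ xs) = y ∷ x ∷ xs
swapAdj (suc i) (x ∷ xs)     = x ∷ swapAdj i xs
swapAdj _       xs           = xs

clearLast : List Bool → List Bool
clearLast []           = []
clearLast (_ ∷ [])     = false ∷ []
clearLast (x ∷ y ∷ xs) = x ∷ clearLast (y ∷ xs)

onehot : ℕ → ℕ → List Bool
onehot zero    q       = []
onehot (suc l) zero    = true ∷ replicate l false
onehot (suc l) (suc q) = false ∷ onehot l q

swapAdj-replicate : ∀ {A : Set} i l (x : A) → swapAdj i (replicate l x) ≡ replicate l x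
swapAdj-replicate zero    zero          x = refl
swapAdj-replicate zero    (suc zero)    x = refl
swapAdj-replicate zero    (suc (suc l)) x = refl
swapAdj-replicate (suc i) zero          x = refl
swapAdj-replicate (suc i) (suc l)       x = cong (x ∷_) (swapAdj-replicate i l x)

clearLast-replicate : ∀ l → clearLast (replicate l false) ≡ replicate l false
clearLast-replicate zero          = refl
clearLast-replicate (suc zero)    = refl
clearLast-replicate (suc (suc l)) = cong (false ∷_) (clearLast-replicate (suc l))

or-onehot : ∀ l q → or (onehot l q) ≡ (q <ᵇ l)
or-onehot zero    zero    = refl
or-onehot zero    (suc q) = refl
or-onehot (suc l) zero    = refl
or-onehot (suc l) (suc q) = or-onehot l q

swapPos : ℕ → ℕ → ℕ
swapPos zero    zero          = 1
swapPos zero    (suc zero)    = 0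
swapPos zero    (suc (suc q)) = suc (suc q)
swapPos (suc i) zero          = zero
swapPos (suc i) (suc q)       = suc (swapPos i q)

-- Position suc m stands for a retired *: onehot (suc m) q has no true entry when q > m.
retire : ℕ → ℕ → ℕ
retire zero    zero    = 1
retire zero    (suc q) = suc q
retire (suc m) zero    = zero
retire (suc m) (suc q) = suc (retire m q)

swapPos-self : ∀ i → swapPos i i ≡ suc i
swapPos-self zero    = refl
swapPos-self (suc i) = cong suc (swapPos-self i)

swapPos-suc : ∀ i → swapPos i (suc i) ≡ i
swapPos-suc zero    = refl
swapPos-suc (suc i) = cong suc (swapPos-suc i)

swapPos-other : ∀ {i q} → q ≢ i → q ≢ suc i → swapPos i q ≡ q
swapPos-other {zero}  {zero}        q≢i _   = contradiction refl q≢i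
swapPos-other {zero}  {suc zero}    _   q≢1 = contradiction refl q≢1
swapPos-other {zero}  {suc (suc q)} _   _   = refl
swapPos-other {suc i} {zero}        _   _   = refl
swapPos-other {suc i} {suc q}       q≢i q≢i+1 =
  cong suc (swapPos-other (q≢i ∘ cong suc) (q≢i+1 ∘ cong suc))

retire-self : ∀ m → retire m m ≡ suc m
retire-self zero    = refl
retire-self (suc m) = cong suc (retire-self m)

retire-other : ∀ {m q} → q ≢ m → retire m q ≡ q
retire-other {zero}  {zero}  q≢m = contradiction refl q≢m
retire-other {zero}  {suc q} _   = refl
retire-other {suc m} {zero}  _   = refl
retire-other {suc m} {suc q} q≢m = cong suc (retire-other (q≢m ∘ cong suc))

retire-≢ : ∀ m q → retire m q ≢ m
retire-≢ zero    zero    ()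
retire-≢ zero    (suc q) ()
retire-≢ (suc m) zero    ()
retire-≢ (suc m) (suc q) eq = retire-≢ m q (suc-injective eq)

swapAdj-onehot : ∀ l i q → suc i < l → swapAdj i (onehot l q) ≡ onehot l (swapPos i q)
swapAdj-onehot (suc zero)    zero    _             (s≤s ())
swapAdj-onehot (suc (suc l)) zero    zero          _         = refl
swapAdj-onehot (suc (suc l)) zero    (suc zero)    _         = refl
swapAdj-onehot (suc (suc l)) zero    (suc (suc q)) _         = refl
swapAdj-onehot (suc l)       (suc i) zero          _         = cong (true ∷_) (swapAdj-replicate i l false)
swapAdj-onehot (suc l)       (suc i) (suc q)       (s≤s i<l) = cong (false ∷_) (swapAdj-onehot l i q i<l)

clearLast-onehot : ∀ m q → clearLast (onehot (suc m) q) ≡ onehot (suc m) (retire m q)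
clearLast-onehot zero          zero          = refl
clearLast-onehot zero          (suc q)       = refl
clearLast-onehot (suc m)       zero          = cong (true ∷_) (clearLast-replicate (suc m))
clearLast-onehot (suc m)       (suc zero)    = cong (false ∷_) (clearLast-onehot m zero)
clearLast-onehot (suc m)       (suc (suc q)) = cong (false ∷_) (clearLast-onehot m (suc q))

-- Only a pair of numbers can be blocked, and such a pair looks the same under isTracked either way.
isTracked-swapAt : ∀ n leq i r → map isTracked (swapAt n leq i r) ≡ swapAdj i (map isTracked r)
isTracked-swapAt n leq zero    []                     = refl
isTracked-swapAt n leq zero    (x ∷ [])               = refl
isTracked-swapAt n leq zero    (num a ∷ num b ∷ r)    with blocked n leq (num a) (num b)
... | true  = refl
... | false = refl
isTracked-swapAt n leq zero    (num a ∷ star ∷ r)     = refl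
isTracked-swapAt n leq zero    (num a ∷ tracked ∷ r)  = refl
isTracked-swapAt n leq zero    (star ∷ y ∷ r)         = refl
isTracked-swapAt n leq zero    (tracked ∷ y ∷ r)      = refl
isTracked-swapAt n leq (suc i) []                     = refl
isTracked-swapAt n leq (suc i) (x ∷ r)                = cong (isTracked x ∷_) (isTracked-swapAt n leq i r)

isTracked-fixLast : ∀ r k → map isTracked (proj₁ (fixLast r k)) ≡ clearLast (map isTracked r)
isTracked-fixLast []             k = refl
isTracked-fixLast (star ∷ [])    k = refl
isTracked-fixLast (tracked ∷ []) k = refl
isTracked-fixLast (num a ∷ [])   k = refl
isTracked-fixLast (x ∷ y ∷ r)    k with fixLast (y ∷ r) k | isTracked-fixLast (y ∷ r) k
... | r′ , _ | ih = cong (isTracked x ∷_) ih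

module PositionChain (m : ℕ) where

  step : ℕ → Bool → ℕ → ℕ
  step i c q = retire m (if c then swapPos i q else q)

  sweepPosFrom : ∀ {j} → ℕ → Vec Bool j → ℕ → ℕ
  sweepPosFrom i []       q = q
  sweepPosFrom i (c ∷ cs) q = sweepPosFrom (suc i) cs (step i c q)

  sweepPos : Vec Bool m → ℕ → ℕ
  sweepPos = sweepPosFrom 0

  runPos : ∀ {t} → Vec (Vec Bool m) t → ℕ → ℕ
  runPos []         q = q
  runPos (cs ∷ css) q = runPos css (sweepPos cs q)

  step-≢ : ∀ i c q → step i c q ≢ m
  step-≢ i c q = retire-≢ m _

  sweepPosFrom-≢ : ∀ {j q} i (cs : Vec Bool j) → q ≢ m → sweepPosFrom i cs q ≢ m
  sweepPosFrom-≢         i []       q≢m = q≢m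
  sweepPosFrom-≢ {q = q} i (c ∷ cs) _   = sweepPosFrom-≢ (suc i) cs (step-≢ i c q)

  step-other : ∀ {i q} c → q ≢ i → q ≢ suc i → q ≢ m → step i c q ≡ q
  step-other true  q≢i q≢i+1 q≢m = trans (cong (retire m) (swapPos-other q≢i q≢i+1)) (retire-other q≢m)
  step-other false _   _     q≢m = retire-other q≢m

  TrackedAt : ℕ → State → Set
  TrackedAt q (r , _) = map isTracked r ≡ onehot (suc m) q

  module _ (leq : ℕ → ℕ → Bool) where

    B-trackedAt : ∀ {i q} s c → i < m → TrackedAt q s → TrackedAt (step i c q) (B (suc m) leq s i c)
    B-trackedAt {i} {q} (r , k) c i<m at = begin
      map isTracked (proj₁ (fixLast r′ k))           ≡⟨ isTracked-fixLast r′ k ⟩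
      clearLast (map isTracked r′)                   ≡⟨ cong clearLast (exchanged c) ⟩
      clearLast (onehot (suc m) q′)                  ≡⟨ clearLast-onehot m q′ ⟩
      onehot (suc m) (retire m q′)                   ∎
      where
      open ≡-Reasoning
      r′ = if c then swapAt (suc m) leq i r else r
      q′ = if c then swapPos i q else q
      exchanged : ∀ c → map isTracked (if c then swapAt (suc m) leq i r else r)
                        ≡ onehot (suc m) (if c then swapPos i q else q)
      exchanged true  = trans (isTracked-swapAt (suc m) leq i r)
                              (trans (cong (swapAdj i) at) (swapAdj-onehot (suc m) i q (s≤s i<m)))
      exchanged false = at

    sweepFrom-trackedAt : ∀ {j q} i (cs : Vec Bool j) s → i + j ≤ m → TrackedAt q s →
                          TrackedAt (sweepPosFrom i cs q) (sweepFrom (suc m) leq i cs s)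
    sweepFrom-trackedAt         i []       s _         at = at
    sweepFrom-trackedAt {suc j} i (c ∷ cs) s i+[1+j]≤m at =
      sweepFrom-trackedAt (suc i) cs (B (suc m) leq s i c) 1+i+j≤m
        (B-trackedAt s c (≤-trans (m≤m+n (suc i) j) 1+i+j≤m) at)
      where
      1+i+j≤m : suc i + j ≤ m
      1+i+j≤m = subst (_≤ m) (+-suc i j) i+[1+j]≤m

    runSweeps-trackedAt : ∀ {t q} (css : Vec (Vec Bool m) t) s → TrackedAt q s →
                          TrackedAt (runPos css q) (runSweeps (suc m) leq css s)
    runSweeps-trackedAt []         s at = at
    runSweeps-trackedAt (cs ∷ css) s at =
      runSweeps-trackedAt css (sweep (suc m) leq cs s) (sweepFrom-trackedAt 0 cs s ≤-refl at)

    alive-runSweeps : ∀ {t q} (css : Vec (Vec Bool m) t) s → TrackedAt q s →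
                      alive (runSweeps (suc m) leq css s) ≡ (runPos css q <ᵇ suc m)
    alive-runSweeps {q = q} css s at =
      trans (cong or (runSweeps-trackedAt css s at)) (or-onehot (suc m) (runPos css q))

module Potential (m : ℕ) where

  open PositionChain m

  potential : ℕ → ℕ
  potential q = (m + q) * (suc m ∸ q)

  potential-zero : potential 0 ≡ suc m * suc m ∸ suc m
  potential-zero = trans (cong (_* suc m) (+-identityʳ m)) (sym (m+n∸m≡n (suc m) (m * suc m)))

  potential-suc : ∀ {q} → q ≤ m → potential q ≡ potential (suc q) + 2 * q
  potential-suc {q} q≤m = begin
    (m + q) * (suc m ∸ q)           ≡⟨ cong ((m + q) *_) (+-∸-assoc 1 q≤m) ⟩
    (m + q) * suc d                 ≡⟨ subst (λ k → (k + q) * suc d ≡ (k + suc q) * d + 2 * q)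
                                             (m+[n∸m]≡n q≤m) (identity q d) ⟩
    (m + suc q) * d + 2 * q         ∎
    where
    open ≡-Reasoning
    d = m ∸ q
    identity : ∀ q d → (q + d + q) * suc d ≡ (q + d + suc q) * d + 2 * q
    identity = solve-∀

  potential-convex : ∀ {i} → i < m → potential i + 2 + potential (suc (suc i)) ≡ 2 * potential (suc i)
  potential-convex {i} i<m
    rewrite potential-suc (<⇒≤ i<m) | potential-suc i<m = identity (potential (suc (suc i))) i
    where
    identity : ∀ a i → a + 2 * suc i + 2 * i + 2 + a ≡ 2 * (a + 2 * suc i)
    identity = solve-∀

  -- sweepValue i q is the expected value of sweepValue m at the end of the sweep when the * sits at q
  -- before step i (sweepValue-step below); sweepValue m is the potential Φ, equal to potential q + 2 at
  -- a live position q < m and to 0 once the * is retired.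
  sweepValue : ℕ → ℕ → ℕ
  sweepValue i q = if q <ᵇ i then potential q + 2 else if does (q ≟ i) then potential (suc i) else potential q

  sweepValue-< : ∀ {i q} → q < i → sweepValue i q ≡ potential q + 2
  sweepValue-< {i} {q} q<i rewrite dec-true (q <? i) q<i = refl

  sweepValue-≡ : ∀ i → sweepValue i i ≡ potential (suc i)
  sweepValue-≡ i rewrite dec-false (i <? i) (<-irrefl refl) | dec-true (i ≟ i) refl = refl

  sweepValue-> : ∀ {i q} → i < q → sweepValue i q ≡ potential q
  sweepValue-> {i} {q} i<q rewrite dec-false (q <? i) (<⇒≯ i<q) | dec-false (q ≟ i) (>⇒≢ i<q) = refl

  sweepValue-other : ∀ {i q} → q ≢ i → q ≢ suc i → sweepValue (suc i) q ≡ sweepValue i q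
  sweepValue-other {i} {q} q≢i q≢i+1 with <-cmp q i
  ... | tri< q<i _ _ = trans (sweepValue-< (m<n⇒m<1+n q<i)) (sym (sweepValue-< q<i))
  ... | tri≈ _ q≡i _ = contradiction q≡i q≢i
  ... | tri> _ _ i<q = trans (sweepValue-> (≤∧≢⇒< i<q (q≢i+1 ∘ sym))) (sym (sweepValue-> i<q))

  sweepValue-retire-suc : ∀ {i} → i < m → sweepValue (suc i) (retire m (suc i)) ≡ potential (suc (suc i))
  sweepValue-retire-suc {i} i<m with suc i ≟ m
  ... | no i+1≢m = trans (cong (sweepValue (suc i)) (retire-other i+1≢m)) (sweepValue-≡ (suc i))
  ... | yes i+1≡m = begin
    sweepValue (suc i) (retire m (suc i))  ≡⟨ cong (sweepValue (suc i) ∘ retire m) i+1≡m ⟩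
    sweepValue (suc i) (retire m m)        ≡⟨ cong (sweepValue (suc i)) (retire-self m) ⟩
    sweepValue (suc i) (suc m)             ≡⟨ sweepValue-> (s≤s i<m) ⟩
    potential (suc m)                      ≡⟨ cong (potential ∘ suc) (sym i+1≡m) ⟩
    potential (suc (suc i))                ∎
    where open ≡-Reasoning

  sweepValue-step : ∀ {i q} → i < m → q ≢ m →
                    sweepValue (suc i) (step i true q) + sweepValue (suc i) (step i false q) ≡ 2 * sweepValue i q
  sweepValue-step {i} {q} i<m q≢m with q ≟ i | q ≟ suc i
  ... | yes refl | _ = begin
    sweepValue (suc q) (retire m (swapPos q q)) + sweepValue (suc q) (retire m q)
      ≡⟨ cong₂ _+_ (cong (sweepValue (suc q) ∘ retire m) (swapPos-self q))
                   (cong (sweepValue (suc q)) (retire-other q≢m)) ⟩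
    sweepValue (suc q) (retire m (suc q)) + sweepValue (suc q) q
      ≡⟨ cong₂ _+_ (sweepValue-retire-suc i<m) (sweepValue-< (n<1+n q)) ⟩
    potential (suc (suc q)) + (potential q + 2)
      ≡⟨ +-comm (potential (suc (suc q))) _ ⟩
    potential q + 2 + potential (suc (suc q))
      ≡⟨ potential-convex i<m ⟩
    2 * potential (suc q)
      ≡⟨ cong (2 *_) (sweepValue-≡ q) ⟨
    2 * sweepValue q q
      ∎
    where open ≡-Reasoning
  ... | no _ | yes refl = begin
    sweepValue (suc i) (retire m (swapPos i (suc i))) + sweepValue (suc i) (retire m (suc i))
      ≡⟨ cong (λ p → sweepValue (suc i) p + sweepValue (suc i) (retire m (suc i)))
              (trans (cong (retire m) (swapPos-suc i)) (retire-other (<⇒≢ i<m))) ⟩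
    sweepValue (suc i) i + sweepValue (suc i) (retire m (suc i))
      ≡⟨ cong₂ _+_ (sweepValue-< (n<1+n i)) (sweepValue-retire-suc i<m) ⟩
    potential i + 2 + potential (suc (suc i))
      ≡⟨ potential-convex i<m ⟩
    2 * potential (suc i)
      ≡⟨ cong (2 *_) (sweepValue-> (n<1+n i)) ⟨
    2 * sweepValue i (suc i)
      ∎
    where open ≡-Reasoning
  ... | no q≢i | no q≢i+1 = begin
    sweepValue (suc i) (step i true q) + sweepValue (suc i) (step i false q)
      ≡⟨ cong₂ _+_ (unmoved true) (unmoved false) ⟩
    sweepValue i q + sweepValue i q
      ≡⟨ cong (_+_ (sweepValue i q)) (+-identityʳ _) ⟨
    2 * sweepValue i q
      ∎
    where
    open ≡-Reasoning
    unmoved : ∀ c → sweepValue (suc i) (step i c q) ≡ sweepValue i q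
    unmoved c = trans (cong (sweepValue (suc i)) (step-other c q≢i q≢i+1 q≢m)) (sweepValue-other q≢i q≢i+1)

  sweepValue-sweepFrom : ∀ j i q → i + j ≡ m → q ≢ m →
                         ∑[ cs ∈ bitVecs j ] sweepValue m (sweepPosFrom i cs q) ≡ 2 ^ j * sweepValue i q
  sweepValue-sweepFrom zero    i q i+0≡m _ =
    cong (λ k → sweepValue k q + 0) (trans (sym i+0≡m) (+-identityʳ i))
  sweepValue-sweepFrom (suc j) i q i+j≡m q≢m = begin
    ∑[ cs ∈ bitVecs (suc j) ] sweepValue m (sweepPosFrom i cs q)
      ≡⟨ sumOver-allVecs (true ∷ false ∷ []) j _ ⟩
    after true + (after false + 0)
      ≡⟨ cong (_+_ (after true)) (+-identityʳ _) ⟩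
    after true + after false
      ≡⟨ cong₂ _+_ (rest true) (rest false) ⟩
    2 ^ j * sweepValue (suc i) (step i true q) + 2 ^ j * sweepValue (suc i) (step i false q)
      ≡⟨ *-distribˡ-+ (2 ^ j) _ _ ⟨
    2 ^ j * (sweepValue (suc i) (step i true q) + sweepValue (suc i) (step i false q))
      ≡⟨ cong (2 ^ j *_) (sweepValue-step i<m q≢m) ⟩
    2 ^ j * (2 * sweepValue i q)
      ≡⟨ identity (2 ^ j) (sweepValue i q) ⟩
    2 ^ suc j * sweepValue i q
      ∎
    where
    open ≡-Reasoning
    after : Bool → ℕ
    after c = ∑[ cs ∈ bitVecs j ] sweepValue m (sweepPosFrom (suc i) cs (step i c q))
    rest : ∀ c → after c ≡ 2 ^ j * sweepValue (suc i) (step i c q)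
    rest c = sweepValue-sweepFrom j (suc i) (step i c q) (trans (sym (+-suc i j)) i+j≡m) (step-≢ i c q)
    i<m : i < m
    i<m = subst (i <_) i+j≡m (m<m+n i z<s)
    identity : ∀ a x → a * (2 * x) ≡ 2 * a * x
    identity = solve-∀

  sweepValue-zero : ∀ q → sweepValue 0 q ≡ potential q
  sweepValue-zero zero    = sym (trans (potential-suc z≤n) (+-identityʳ _))
  sweepValue-zero (suc q) = sweepValue-> z<s

  sweepValue-decrease : ∀ {q} → q ≢ m → 2 * indicator (q <ᵇ suc m) + sweepValue 0 q ≤ sweepValue m q
  sweepValue-decrease {q} q≢m rewrite sweepValue-zero q with <-cmp q m
  ... | tri< q<m _ _ rewrite dec-true (q <? suc m) (m<n⇒m<1+n q<m) | sweepValue-< q<m =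
    ≤-reflexive (+-comm 2 (potential q))
  ... | tri≈ _ q≡m _ = contradiction q≡m q≢m
  ... | tri> _ _ m<q rewrite dec-false (q <? suc m) (≤⇒≯ m<q) | sweepValue-> m<q = ≤-refl

module Survival (m : ℕ) where

  open PositionChain m
  open Potential m

  survivorsPos : ℕ → ℕ → ℕ
  survivorsPos q t = ∑[ css ∈ allVecs (bitVecs m) t ] indicator (runPos css q <ᵇ suc m)

  outcomes : ℕ → ℕ
  outcomes T = 2 ^ (m * T)

  outcomes-suc : ∀ T → outcomes (suc T) ≡ 2 ^ m * outcomes T
  outcomes-suc T = trans (cong (2 ^_) (*-suc m T)) (^-distribˡ-+-* 2 m (m * T))

  -- outcomes T · Σ_{t<T} P(τ > t) for the * started at q
  scaledTail : ℕ → ℕ → ℕ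
  scaledTail q zero    = 0
  scaledTail q (suc T) = 2 ^ m * (scaledTail q T + survivorsPos q T)

  scaledTail-firstSweep : ∀ T q → scaledTail q (suc T) ≡
    indicator (q <ᵇ suc m) * outcomes (suc T) + ∑[ cs ∈ bitVecs m ] scaledTail (sweepPos cs q) T
  scaledTail-firstSweep zero q rewrite sumOver-zero (bitVecs m) | *-identityʳ m =
    identity (indicator (q <ᵇ suc m)) (2 ^ m)
    where
    identity : ∀ a b → b * (a + 0) ≡ a * b + 0
    identity = solve-∀
  scaledTail-firstSweep (suc T) q = begin
    2 ^ m * (scaledTail q (suc T) + survivorsPos q (suc T))
      ≡⟨ cong₂ (λ a b → 2 ^ m * (a + b)) (scaledTail-firstSweep T q) (sumOver-allVecs (bitVecs m) T _) ⟩
    2 ^ m * ((isAlive * outcomes (suc T) + X) + Y)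
      ≡⟨ identity (2 ^ m) isAlive (outcomes (suc T)) X Y ⟩
    isAlive * (2 ^ m * outcomes (suc T)) + 2 ^ m * (X + Y)
      ≡⟨ cong₂ (λ a b → isAlive * a + 2 ^ m * b) (outcomes-suc (suc T)) (sumOver-+ (bitVecs m) _ _) ⟨
    isAlive * outcomes (suc (suc T))
      + 2 ^ m * ∑[ cs ∈ bitVecs m ] (scaledTail (sweepPos cs q) T + survivorsPos (sweepPos cs q) T)
      ≡⟨ cong (_+_ (isAlive * outcomes (suc (suc T)))) (sumOver-* (bitVecs m) (2 ^ m) _) ⟨
    isAlive * outcomes (suc (suc T)) + ∑[ cs ∈ bitVecs m ] scaledTail (sweepPos cs q) (suc T)
      ∎
    where
    open ≡-Reasoning
    isAlive = indicator (q <ᵇ suc m)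
    X = ∑[ cs ∈ bitVecs m ] scaledTail (sweepPos cs q) T
    Y = ∑[ cs ∈ bitVecs m ] survivorsPos (sweepPos cs q) T
    identity : ∀ n a d x y → n * ((a * d + x) + y) ≡ a * (n * d) + n * (x + y)
    identity = solve-∀

  -- the optional-stopping inequality 2 E[min(τ, T)] ≤ Φ(q), scaled by outcomes T
  scaledTail-bound : ∀ T {q} → q ≢ m → 2 * scaledTail q T ≤ outcomes T * sweepValue m q
  scaledTail-bound zero    q≢m = z≤n
  scaledTail-bound (suc T) {q} q≢m = begin
    2 * scaledTail q (suc T)
      ≡⟨ cong (2 *_) (scaledTail-firstSweep T q) ⟩
    2 * (isAlive * outcomes (suc T) + X)
      ≡⟨ identity₁ isAlive (outcomes (suc T)) X ⟩
    2 * isAlive * outcomes (suc T) + 2 * X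
      ≤⟨ +-monoʳ-≤ (2 * isAlive * outcomes (suc T)) laterSweeps ⟩
    2 * isAlive * outcomes (suc T) + outcomes T * ∑[ cs ∈ bitVecs m ] sweepValue m (sweepPos cs q)
      ≡⟨ cong₂ (λ a b → 2 * isAlive * a + outcomes T * b) (outcomes-suc T) (sweepValue-sweepFrom m 0 q refl q≢m) ⟩
    2 * isAlive * (2 ^ m * outcomes T) + outcomes T * (2 ^ m * sweepValue 0 q)
      ≡⟨ identity₂ isAlive (2 ^ m) (outcomes T) (sweepValue 0 q) ⟩
    2 ^ m * outcomes T * (2 * isAlive + sweepValue 0 q)
      ≤⟨ *-monoʳ-≤ (2 ^ m * outcomes T) (sweepValue-decrease q≢m) ⟩
    2 ^ m * outcomes T * sweepValue m q
      ≡⟨ cong (_* sweepValue m q) (outcomes-suc T) ⟨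
    outcomes (suc T) * sweepValue m q
      ∎
    where
    open ≤-Reasoning
    isAlive = indicator (q <ᵇ suc m)
    X = ∑[ cs ∈ bitVecs m ] scaledTail (sweepPos cs q) T
    laterSweeps : 2 * X ≤ outcomes T * ∑[ cs ∈ bitVecs m ] sweepValue m (sweepPos cs q)
    laterSweeps = begin
      2 * X
        ≡⟨ sumOver-* (bitVecs m) 2 _ ⟨
      ∑[ cs ∈ bitVecs m ] (2 * scaledTail (sweepPos cs q) T)
        ≤⟨ sumOver-mono (bitVecs m) (λ cs → scaledTail-bound T (sweepPosFrom-≢ 0 cs q≢m)) ⟩
      ∑[ cs ∈ bitVecs m ] (outcomes T * sweepValue m (sweepPos cs q))
        ≡⟨ sumOver-* (bitVecs m) (outcomes T) _ ⟩
      outcomes T * ∑[ cs ∈ bitVecs m ] sweepValue m (sweepPos cs q)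
        ∎
    identity₁ : ∀ a d x → 2 * (a * d + x) ≡ 2 * a * d + 2 * x
    identity₁ = solve-∀
    identity₂ : ∀ a n d w → 2 * a * (n * d) + d * (n * w) ≡ n * d * (2 * a + w)
    identity₂ = solve-∀

toℚᵘ-/ : ∀ a d .{{_ : NonZero d}} → toℚᵘ (+ a / d) ≃ (+ a) ℚᵘ./ d
toℚᵘ-/ a (suc d) = toℚᵘ-fromℚᵘ (mkℚᵘ (+ a) d)

0≃0/ : ∀ d .{{_ : NonZero d}} → 0ℚᵘ ≃ (+ 0) ℚᵘ./ d
0≃0/ (suc d) = *≡* refl

/-+-/-same-denominator : ∀ a b c d e .{{_ : NonZero c}} .{{_ : NonZero d}} .{{_ : NonZero e}} → e ≡ c * d →
  ((+ a) ℚᵘ./ d) ℚᵘ.+ ((+ b) ℚᵘ./ d) ≃ (+ (c * (a + b))) ℚᵘ./ e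
/-+-/-same-denominator a b (suc c) (suc d) .(suc c * suc d) refl = *≡* (begin
  ((+ a) ℤ.* (+ d′) ℤ.+ (+ b) ℤ.* (+ d′)) ℤ.* (+ (c′ * d′))
    ≡⟨ cong₂ (λ x y → (x ℤ.+ y) ℤ.* (+ (c′ * d′))) (pos-* a d′) (pos-* b d′) ⟨
  ((+ (a * d′)) ℤ.+ (+ (b * d′))) ℤ.* (+ (c′ * d′))
    ≡⟨ cong (ℤ._* (+ (c′ * d′))) (pos-+ (a * d′) (b * d′)) ⟨
  (+ (a * d′ + b * d′)) ℤ.* (+ (c′ * d′))
    ≡⟨ pos-* (a * d′ + b * d′) (c′ * d′) ⟨
  + ((a * d′ + b * d′) * (c′ * d′))
    ≡⟨ cong +_ (identity a b c′ d′) ⟩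
  + ((c′ * (a + b)) * (d′ * d′))
    ≡⟨ pos-* (c′ * (a + b)) (d′ * d′) ⟩
  (+ (c′ * (a + b))) ℤ.* (+ (d′ * d′))
    ∎)
  where
  open ≡-Reasoning
  c′ = suc c
  d′ = suc d
  identity : ∀ a b c d → (a * d + b * d) * (c * d) ≡ (c * (a + b)) * (d * d)
  identity = solve-∀

cross-≤⇒/≤/ : ∀ a b c d .{{_ : NonZero c}} .{{_ : NonZero d}} → a * d ≤ b * c → (+ a) ℚᵘ./ c ℚᵘ.≤ (+ b) ℚᵘ./ d
cross-≤⇒/≤/ a b (suc c) (suc d) ad≤bc = *≤* (subst₂ ℤ._≤_ (pos-* a (suc d)) (pos-* b (suc c)) (ℤ.+≤+ ad≤bc))

startState-trackedAt : ∀ {m r k} → IsStartState (suc m) (r , k) → PositionChain.TrackedAt m 0 (r , k)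
startState-trackedAt {m} {tracked ∷ r} (length≡ , _ , _ , _ , _ , refl , once) =
  cong (true ∷_) (trans (map≡replicate-false r isTracked noOther) (cong (λ l → replicate l false) (suc-injective length≡)))
  where
  noOther : ∑[ e ∈ r ] indicator (isTracked e) ≡ 0
  noOther = suc-injective (trans (sym (length-filter-≡true (tracked ∷ r) isTracked)) once)

module TailSum (m : ℕ) (leq : ℕ → ℕ → Bool) where

  open PositionChain m
  open Survival m

  instance
    outcomes-nonZero : ∀ {T} → NonZero (outcomes T)
    outcomes-nonZero {T} = m^n≢0 2 (m * T)
    2^m-nonZero : NonZero (2 ^ m)
    2^m-nonZero = m^n≢0 2 m

  survivors≡survivorsPos : ∀ {q} s → TrackedAt q s → ∀ t → survivors (suc m) leq s t ≡ survivorsPos q t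
  survivors≡survivorsPos s at t =
    trans (length-filter-≡true (allVecs (bitVecs m) t) _)
          (sumOver-cong (allVecs (bitVecs m) t) (λ css → cong indicator (alive-runSweeps leq css s at)))

  tailSum≃scaledTail : ∀ {q} s → TrackedAt q s → ∀ T → toℚᵘ (tailSum (suc m) leq s T) ≃ (+ scaledTail q T) ℚᵘ./ outcomes T
  tailSum≃scaledTail s at zero    = 0≃0/ (outcomes 0)
  tailSum≃scaledTail {q} s at (suc T) = begin
    toℚᵘ (tailSum (suc m) leq s T Data.Rational.+ probGt (suc m) leq s T)
      ≈⟨ toℚᵘ-homo-+ (tailSum (suc m) leq s T) (probGt (suc m) leq s T) ⟩
    toℚᵘ (tailSum (suc m) leq s T) ℚᵘ.+ toℚᵘ (probGt (suc m) leq s T)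
      ≈⟨ +-cong (tailSum≃scaledTail s at T) (toℚᵘ-/ (survivors (suc m) leq s T) (outcomes T)) ⟩
    (+ scaledTail q T) ℚᵘ./ outcomes T ℚᵘ.+ (+ survivors (suc m) leq s T) ℚᵘ./ outcomes T
      ≡⟨ cong (λ x → (+ scaledTail q T) ℚᵘ./ outcomes T ℚᵘ.+ (+ x) ℚᵘ./ outcomes T) (survivors≡survivorsPos s at T) ⟩
    (+ scaledTail q T) ℚᵘ./ outcomes T ℚᵘ.+ (+ survivorsPos q T) ℚᵘ./ outcomes T
      ≈⟨ /-+-/-same-denominator (scaledTail q T) (survivorsPos q T) (2 ^ m) (outcomes T) (outcomes (suc T)) (outcomes-suc T) ⟩
    (+ scaledTail q (suc T)) ℚᵘ./ outcomes (suc T)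
      ∎
    where open ≃-Reasoning

lemma5 : (n : ℕ) → 2 ≤ n → (leq : ℕ → ℕ → Bool) → IsPartialOrderOn n leq →
         (r : List Entry) (k : ℕ) → IsStartState n (r , k) →
         (T : ℕ) → Data.Rational._≤_ (tailSum n leq (r , k) T) ((+ (n * n ∸ n + 2)) / 2)
lemma5 (suc zero)        (s≤s ())
lemma5 n@(suc m@(suc _)) _ leq _ r k isStart T = toℚᵘ-cancel-≤ rationalBound
  where
  open TailSum m leq
  open Survival m
  open Potential m

  scaledBound : scaledTail 0 T * 2 ≤ (n * n ∸ n + 2) * outcomes T
  scaledBound = begin
    scaledTail 0 T * 2            ≡⟨ *-comm (scaledTail 0 T) 2 ⟩
    2 * scaledTail 0 T            ≤⟨ scaledTail-bound T (λ ()) ⟩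
    outcomes T * sweepValue m 0   ≡⟨ *-comm (outcomes T) (sweepValue m 0) ⟩
    sweepValue m 0 * outcomes T   ≡⟨ cong (_* outcomes T) (sweepValue-< {m} z<s) ⟩
    (potential 0 + 2) * outcomes T ≡⟨ cong (λ v → (v + 2) * outcomes T) potential-zero ⟩
    (n * n ∸ n + 2) * outcomes T  ∎
    where open ≤-Reasoning

  rationalBound : toℚᵘ (tailSum n leq (r , k) T) ℚᵘ.≤ toℚᵘ ((+ (n * n ∸ n + 2)) / 2)
  rationalBound =
    ≤-respˡ-≃ (≃-sym (tailSum≃scaledTail (r , k) (startState-trackedAt isStart) T))
      (≤-respʳ-≃ (≃-sym (toℚᵘ-/ (n * n ∸ n + 2) 2))
        (cross-≤⇒/≤/ (scaledTail 0 T) _ (outcomes T) 2 {{outcomes-nonZero {T}}} scaledBound))
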